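{- Let $K$ and $L$ be sets of positive integers, and suppose $(X,\mathcal{G},\mathcal{A})$ is a $(K,1)$-GDD with group sizes in $L$ such that: (1) for every $k\in K$ there is a nested $(4,1)$-GDD of type $3^k$; and (2) for every $\ell\in L$ there is a nested $(3\ell+1,4,1)$-BIBD. Then there is a nested $(3|X|+1,4,1)$-BIBD.
   Context: A $(v,k,\lambda)$-BIBD is a pair $(X,\mathcal{A})$ with $X$ a set of $v$ points and $\mathcal{A}$ a collection of $k$-subsets (blocks) such that every pair of distinct points lies in exactly $\lambda$ blocks; a partial one has "at most $\lambda$". A nested $(v,k,\lambda)$-BIBD is a $(v,k,\lambda)$-BIBD $(X,\mathcal{A})$ together with a map $\phi:\mathcal{A}\to X$ such that $(X,\{A\cup\{\phi(A)\}:A\in\mathcal{A}\})$ is a partial $(v,k+1,\lambda+1)$-BIBD (each augmented block of size $k+1$). A $(k,\lambda)$-GDD of type $t^u$ is a triple $(Y,\mathcal{G},\mathcal{B})$ with $|Y|=tu$, $\mathcal{G}$ a partition of $Y$ into $u$ groups of size $t$, $\mathcal{B}$ a multiset of $k$-subsets each meeting each group in at most one point, such that every pair of points from different groups lies in exactly $\lambda$ blocks; a partial GDD has "at most $\lambda$". It is nested if there is $\phi:\mathcal{B}\to Y$ with $(Y,\mathcal{G},\{B\cup\{\phi(B)\}\})$ a partial $(k+1,\lambda+1)$-GDD of type $t^u$. A $(K,1)$-GDD with group sizes in $L$ is a triple $(X,\mathcal{G},\mathcal{A})$ where $\mathcal{G}$ is a partition of the point set $X$ into groups with sizes in $L$,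 and $\mathcal{A}$ is a set of blocks with sizes in $K$, each meeting every group in at most one point, such that every pair of points from different groups lies in exactly one block. -}

module Defs where

open import Data.Nat using (ℕ; suc; _≤_; _<_; _*_; _+_)
open import Data.Fin using (Fin)
open import Data.Fin.Subset using (Subset; _∪_; _∩_; ⁅_⁆; ∣_∣)
open import Data.Fin.Subset.Properties using (_∈?_)
open import Data.List using (List; map; filter; length)
open import Data.List.Membership.Propositional using () renaming (_∈_ to _∈ₗ_)
open import Data.List.Relation.Unary.Unique.Propositional using (Unique)
open import Data.Product using (_×_; proj₁; proj₂)
open import Relation.Nullary using (¬_)
open import Relation.Nullary.Decidable using (_×-dec_)
open import Relation.Binary.PropositionalEquality using (_≡_)

-- Point sets are Fin v; blocks and groups are subsets of Fin v;
-- a collection of blocks is a list (= multiset) of subsets.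

pairCount : ∀ {v} → List (Subset v) → Fin v → Fin v → ℕ
pairCount Bs x y = length (filter (λ B → (x ∈? B) ×-dec (y ∈? B)) Bs)

pointCount : ∀ {v} → List (Subset v) → Fin v → ℕ
pointCount Gs x = length (filter (λ G → x ∈? G) Gs)

-- augmented blocks B ∪ {φ(B)}; a nesting is recorded as a list of pairs (B , φ(B))
augment : ∀ {v} → List (Subset v × Fin v) → List (Subset v)
augment = map (λ Bp → proj₁ Bp ∪ ⁅ proj₂ Bp ⁆)

record IsBIBD (v k lam : ℕ) (Bs : List (Subset v)) : Set where
  field
    blockSize : ∀ B → B ∈ₗ Bs → ∣ B ∣ ≡ k
    balanced  : ∀ (x y : Fin v) → ¬ x ≡ y → pairCount Bs x y ≡ lam

record IsPartialBIBD (v k lam : ℕ) (Bs : List (Subset v)) : Set where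
  field
    blockSize : ∀ B → B ∈ₗ Bs → ∣ B ∣ ≡ k
    balanced  : ∀ (x y : Fin v) → ¬ x ≡ y → pairCount Bs x y ≤ lam

record NestedBIBD (v k lam : ℕ) : Set where
  field
    nested    : List (Subset v × Fin v)
    isBIBD    : IsBIBD v k lam (map proj₁ nested)
    isPartial : IsPartialBIBD v (suc k) (suc lam) (augment nested)

IsPartition : ∀ {n} → List (Subset n) → Set
IsPartition {n} Gs = ∀ (x : Fin n) → pointCount Gs x ≡ 1

SameGroup : ∀ {n} → List (Subset n) → Fin n → Fin n → Set
SameGroup Gs x y = 1 ≤ pairCount Gs x y

Transversal : ∀ {n} → List (Subset n) → List (Subset n) → Set
Transversal Gs Bs = ∀ B G → B ∈ₗ Bs → G ∈ₗ Gs → ∣ B ∩ G ∣ ≤ 1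

record GDD (k lam t u : ℕ) : Set where
  field
    groups      : List (Subset (t * u))
    numGroups   : length groups ≡ u
    groupSize   : ∀ G → G ∈ₗ groups → ∣ G ∣ ≡ t
    partition   : IsPartition groups
    blocks      : List (Subset (t * u))
    blockSize   : ∀ B → B ∈ₗ blocks → ∣ B ∣ ≡ k
    transversal : Transversal groups blocks
    balanced    : ∀ x y → ¬ SameGroup groups x y → pairCount blocks x y ≡ lam

record NestedGDD (k lam t u : ℕ) : Set where
  field
    groups       : List (Subset (t * u))
    numGroups    : length groups ≡ u
    groupSize    : ∀ G → G ∈ₗ groups → ∣ G ∣ ≡ t
    partition    : IsPartition groups
    nested       : List (Subset (t * u) × Fin (t * u))
    blockSize    : ∀ B → B ∈ₗ map proj₁ nested → ∣ B ∣ ≡ k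
    transversal  : Transversal groups (map proj₁ nested)
    balanced     : ∀ x y → ¬ SameGroup groups x y
                     → pairCount (map proj₁ nested) x y ≡ lam
    augSize      : ∀ B → B ∈ₗ augment nested → ∣ B ∣ ≡ suc k
    augTransv    : Transversal groups (augment nested)
    augBalanced  : ∀ x y → ¬ SameGroup groups x y
                     → pairCount (augment nested) x y ≤ suc lam

record KGDD (K L : ℕ → Set) (n : ℕ) : Set where
  field
    groups      : List (Subset n)
    groupSize   : ∀ G → G ∈ₗ groups → L ∣ G ∣
    partition   : IsPartition groups
    blocks      : List (Subset n)
    blocksSet   : Unique blocks
    blockSize   : ∀ B → B ∈ₗ blocks → K ∣ B ∣
    transversal : Transversal groups blocks
    balanced    : ∀ x y → ¬ SameGroup groups x y → pairCount blocks x y ≡ 1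

-- Put X × Z₃ together with a new point ∞. On {∞} ∪ G × Z₃ place a copy of the nested
-- (3|G|+1,4,1)-BIBD of each group G, and on B × Z₃ a copy of the nested (4,1)-GDD of type 3^|B|
-- of each block B, its groups being the fibres {x} × Z₃. Every pair of distinct points is
-- covered by exactly one copy: a pair through ∞, or inside G × Z₃ for a group G, by the BIBD of G
-- (the GDDs never cover pairs inside a fibre, and no block meets a group twice); a pair between
-- fibres over points in different groups by the GDD of the unique block through them. The same
-- bookkeeping for the augmented blocks bounds every pair count by 2.
module Submission where

open import Defs
open import Data.Nat using (ℕ; zero; suc; _+_; _*_; _≤_; _<_; _≤?_; s≤s; z≤n)
open import Data.Nat.ListAction using (sum)
open import Data.Nat.Properties using (+-identityʳ; ≤-trans; ≤-reflexive; n≤1+n; 1+n≰n; suc-injective)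
open import Data.Fin using (Fin; zero; suc; cast; _↑ˡ_; _↑ʳ_; splitAt; join; combine; remQuot; _≟_)
import Data.Fin.Properties as Finₚ
open import Data.Fin.Subset using (Subset; inside; outside; _∈_; _∉_; _∪_; _-_; ⁅_⁆; ⊥; ∣_∣)
open import Data.Fin.Subset.Properties
  using (_∈?_; ∉⊥; ∣⊥∣≡0; x∈⁅x⁆; x∈⁅y⁆⇒x≡y; ∣⁅x⁆∣≡1; x∈p∪q⁺; x∈p∪q⁻; x∈p∩q⁺; ∪-identityˡ; ⊆-antisym;
         drop-there; x∈p∧x≢y⇒x∈p-y; x∈p⇒∣p-x∣<∣p∣; p⊆q⇒∣p∣≤∣q∣)
open import Data.Vec using ([]; _∷_; here; there)
open import Data.List using (List; []; _∷_; _++_; concat; map; filter; length; lookup)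
open import Data.List.Properties
  using (filter-++; length-++; filter-none; map-id; map-∘; map-cong; map-++; concat-map)
open import Data.List.Membership.Propositional using (mapWith∈; find) renaming (_∈_ to _∈ₗ_)
open import Data.List.Membership.Propositional.Properties
  using (∈-lookup; ∈-map⁻; ∈-concat⁻; ∈-++⁻; map-mapWith∈; mapWith∈-cong)
open import Data.List.Relation.Unary.All using (tabulate)
open import Data.List.Relation.Unary.Any using (Any; here; there; index)
open import Data.List.Relation.Unary.Any.Properties using (lookup-index; mapWith∈⁻)
open import Data.Product using (∃; ∃₂; _×_; _,_; proj₁; proj₂; uncurry; map₂)
open import Data.Sum using (inj₁; inj₂; map₁)
open import Data.Empty using (⊥-elim)
open import Function using (_∘_; id; case_of_)
open import Function.Definitions using (Injective)
open import Relation.Nullary using (¬_; yes; no; contradiction)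
open import Relation.Nullary.Decidable using (_×-dec_)
open import Relation.Unary using (Pred; Decidable)
open import Relation.Binary.PropositionalEquality
  using (_≡_; _≢_; refl; sym; trans; cong; cong₂; subst; module ≡-Reasoning)

private variable
  m n : ℕ

module _ {a p} {A : Set a} {P : Pred A p} (P? : Decidable P) where

  count : List A → ℕ
  count xs = length (filter P? xs)

  count-++ : ∀ xs ys → count (xs ++ ys) ≡ count xs + count ys
  count-++ xs ys = trans (cong length (filter-++ P? xs ys)) (length-++ (filter P? xs))

  count-concat : ∀ xss → count (concat xss) ≡ sum (map count xss)
  count-concat []         = refl
  count-concat (xs ∷ xss) = trans (count-++ xs (concat xss)) (cong (count xs +_) (count-concat xss))

  count-none : ∀ xs → (∀ {x} → x ∈ₗ xs → ¬ P x) → count xs ≡ 0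
  count-none xs ¬P = cong length (filter-none P? (tabulate ¬P))

  count≡0⇒¬ : ∀ {xs x} → count xs ≡ 0 → x ∈ₗ xs → ¬ P x
  count≡0⇒¬ {y ∷ xs} c (here refl) py with P? y
  ... | no ¬py = ¬py py
  count≡0⇒¬ {y ∷ xs} c (there x∈xs) px with P? y
  ... | no _ = count≡0⇒¬ c x∈xs px

  ∈⇒1≤count : ∀ {xs x} → x ∈ₗ xs → P x → 1 ≤ count xs
  ∈⇒1≤count {y ∷ xs} x∈xs px with P? y
  ... | yes _ = s≤s z≤n
  ∈⇒1≤count {y ∷ xs} (here refl)  py | no ¬py = ⊥-elim (¬py py)
  ∈⇒1≤count {y ∷ xs} (there x∈xs) px | no _   = ∈⇒1≤count x∈xs px

  1≤count⇒Any : ∀ {xs} → 1 ≤ count xs → Any P xs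
  1≤count⇒Any {y ∷ xs} c with P? y
  ... | yes py = here py
  ... | no _   = there (1≤count⇒Any c)

  count≤1⇒lookup-injective : ∀ xs → count xs ≤ 1 → ∀ {i j}
                           → P (lookup xs i) → P (lookup xs j) → i ≡ j
  count≤1⇒lookup-injective (y ∷ xs) c {zero}  {zero}  _  _  = refl
  count≤1⇒lookup-injective (y ∷ xs) c {zero}  {suc j} py pj with P? y
  ... | yes _  = ⊥-elim (1+n≰n (≤-trans (s≤s (∈⇒1≤count (∈-lookup {xs = xs} j) pj)) c))
  ... | no ¬py = ⊥-elim (¬py py)
  count≤1⇒lookup-injective (y ∷ xs) c {suc i} {zero}  pi py =
    sym (count≤1⇒lookup-injective (y ∷ xs) c py pi)
  count≤1⇒lookup-injective (y ∷ xs) c {suc i} {suc j} pi pj with P? y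
  ... | yes _ = cong suc (count≤1⇒lookup-injective xs (≤-trans (n≤1+n _) c) pi pj)
  ... | no _  = cong suc (count≤1⇒lookup-injective xs c pi pj)

count-concat-mapWith∈ : ∀ {a b p} {A : Set a} {B : Set b} {P : Pred B p} (P? : Decidable P)
                        (xs : List A) (F : ∀ {x} → x ∈ₗ xs → List B)
                      → count P? (concat (mapWith∈ xs F)) ≡ sum (mapWith∈ xs (count P? ∘ F))
count-concat-mapWith∈ P? xs F =
  trans (count-concat P? (mapWith∈ xs F)) (cong sum (map-mapWith∈ xs F (count P?)))

count-map : ∀ {a b p q} {A : Set a} {B : Set b} {P : Pred B p} {Q : Pred A q} (P? : Decidable P) (Q? : Decidable Q)
            (g : A → B) → (∀ {x} → P (g x) → Q x) → (∀ {x} → Q x → P (g x))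
          → ∀ xs → count P? (map g xs) ≡ count Q? xs
count-map P? Q? g P⇒Q Q⇒P []       = refl
count-map P? Q? g P⇒Q Q⇒P (x ∷ xs) with P? (g x) | Q? x
... | yes _   | yes _  = cong suc (count-map P? Q? g P⇒Q Q⇒P xs)
... | no _    | no _   = count-map P? Q? g P⇒Q Q⇒P xs
... | yes pgx | no ¬qx = contradiction (P⇒Q pgx) ¬qx
... | no ¬pgx | yes qx = contradiction (Q⇒P qx) ¬pgx

module _ {a} {A : Set a} where

  sum-mapWith∈-zero : (xs : List A) (f : ∀ {x} → x ∈ₗ xs → ℕ) → (∀ {x} (x∈xs : x ∈ₗ xs) → f x∈xs ≡ 0)
                    → sum (mapWith∈ xs f) ≡ 0
  sum-mapWith∈-zero []       f f≡0 = refl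
  sum-mapWith∈-zero (x ∷ xs) f f≡0 rewrite f≡0 (here refl) =
    sum-mapWith∈-zero xs (f ∘ there) (f≡0 ∘ there)

  sum-mapWith∈-single : ∀ {p r} {Q : Pred A p} (Q? : Decidable Q) {R : ℕ → Set r}
                        (xs : List A) (f : ∀ {x} → x ∈ₗ xs → ℕ)
                      → count Q? xs ≡ 1
                      → (∀ {x} (x∈xs : x ∈ₗ xs) → Q x → R (f x∈xs))
                      → (∀ {x} (x∈xs : x ∈ₗ xs) → ¬ Q x → f x∈xs ≡ 0)
                      → R (sum (mapWith∈ xs f))
  sum-mapWith∈-single Q? {R} (x ∷ xs) f c R-f f≡0 with Q? x
  ... | yes qx = subst R (sym f₀+rest≡f₀) (R-f (here refl) qx)
    where
    f₀+rest≡f₀ : f (here refl) + sum (mapWith∈ xs (f ∘ there)) ≡ f (here refl)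
    f₀+rest≡f₀ = trans (cong (f (here refl) +_) (sum-mapWith∈-zero xs (f ∘ there) λ x∈xs →
                          f≡0 (there x∈xs) (count≡0⇒¬ Q? (suc-injective c) x∈xs)))
                       (+-identityʳ _)
  ... | no ¬qx rewrite f≡0 (here refl) ¬qx =
    sum-mapWith∈-single Q? {R} xs (f ∘ there) c (R-f ∘ there) (f≡0 ∘ there)

∈-concat-mapWith∈⁻ : ∀ {a b} {A : Set a} {B : Set b} (xs : List A) (F : ∀ {x} → x ∈ₗ xs → List B) {y}
                   → y ∈ₗ concat (mapWith∈ xs F) → ∃₂ λ x (x∈xs : x ∈ₗ xs) → y ∈ₗ F x∈xs
∈-concat-mapWith∈⁻ xs F y∈ = mapWith∈⁻ xs F (∈-concat⁻ (mapWith∈ xs F) y∈)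

map-concat-mapWith∈ : ∀ {a b c} {A : Set a} {B : Set b} {C : Set c}
                      (g : B → C) (xs : List A) (F : ∀ {x} → x ∈ₗ xs → List B)
                    → map g (concat (mapWith∈ xs F)) ≡ concat (mapWith∈ xs (map g ∘ F))
map-concat-mapWith∈ g xs F = trans (sym (concat-map (mapWith∈ xs F))) (cong concat (map-mapWith∈ xs F (map g)))

image : (Fin m → Fin n) → Subset m → Subset n
image {zero}  f []            = ⊥
image {suc m} f (outside ∷ p) = image (f ∘ suc) p
image {suc m} f (inside ∷ p)  = ⁅ f zero ⁆ ∪ image (f ∘ suc) p

∈-image⁺ : ∀ (f : Fin m → Fin n) {p x} → x ∈ p → f x ∈ image f p
∈-image⁺ f {inside ∷ p}  here        = x∈p∪q⁺ (inj₁ (x∈⁅x⁆ (f zero)))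
∈-image⁺ f {outside ∷ p} (there x∈p) = ∈-image⁺ (f ∘ suc) x∈p
∈-image⁺ f {inside ∷ p}  (there x∈p) = x∈p∪q⁺ (inj₂ (∈-image⁺ (f ∘ suc) x∈p))

∈-image⁻ : ∀ (f : Fin m → Fin n) p {y} → y ∈ image f p → ∃ λ x → x ∈ p × f x ≡ y
∈-image⁻ {zero}  f []            y∈ = contradiction y∈ ∉⊥
∈-image⁻ {suc m} f (outside ∷ p) y∈ with ∈-image⁻ (f ∘ suc) p y∈
... | x , x∈p , refl = suc x , there x∈p , refl
∈-image⁻ {suc m} f (inside ∷ p)  y∈ with x∈p∪q⁻ ⁅ f zero ⁆ (image (f ∘ suc) p) y∈
... | inj₁ y∈⁅f0⁆ = zero , here , sym (x∈⁅y⁆⇒x≡y (f zero) y∈⁅f0⁆)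
... | inj₂ y∈rest with ∈-image⁻ (f ∘ suc) p y∈rest
...   | x , x∈p , refl = suc x , there x∈p , refl

∈-image⁻-injective : ∀ {f : Fin m → Fin n} → Injective _≡_ _≡_ f → ∀ p {x} → f x ∈ image f p → x ∈ p
∈-image⁻-injective f-inj p fx∈ with ∈-image⁻ _ p fx∈
... | x , x∈p , fx≡ = subst (_∈ p) (f-inj fx≡) x∈p

∣⁅x⁆∪p∣≡1+∣p∣ : ∀ {x : Fin n} {p} → x ∉ p → ∣ ⁅ x ⁆ ∪ p ∣ ≡ suc ∣ p ∣
∣⁅x⁆∪p∣≡1+∣p∣ {x = zero}  {inside ∷ p}  x∉p = contradiction here x∉p
∣⁅x⁆∪p∣≡1+∣p∣ {x = zero}  {outside ∷ p} x∉p = cong (suc ∘ ∣_∣) (∪-identityˡ p)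
∣⁅x⁆∪p∣≡1+∣p∣ {x = suc x} {outside ∷ p} x∉p = ∣⁅x⁆∪p∣≡1+∣p∣ (x∉p ∘ there)
∣⁅x⁆∪p∣≡1+∣p∣ {x = suc x} {inside ∷ p}  x∉p = cong suc (∣⁅x⁆∪p∣≡1+∣p∣ (x∉p ∘ there))

∣image∣ : ∀ {f : Fin m → Fin n} → Injective _≡_ _≡_ f → ∀ p → ∣ image f p ∣ ≡ ∣ p ∣
∣image∣ {zero}  {n} f-inj []            = ∣⊥∣≡0 n
∣image∣ {suc m}     f-inj (outside ∷ p) = ∣image∣ (Finₚ.suc-injective ∘ f-inj) p
∣image∣ {suc m} {f = f} f-inj (inside ∷ p) =
  trans (∣⁅x⁆∪p∣≡1+∣p∣ f0∉) (cong suc (∣image∣ (Finₚ.suc-injective ∘ f-inj) p))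
  where
  f0∉ : f zero ∉ image (f ∘ suc) p
  f0∉ f0∈ with ∈-image⁻ (f ∘ suc) p f0∈
  ... | x , _ , fsx≡f0 with f-inj fsx≡f0
  ... | ()

image-∪-⁅⁆ : ∀ (f : Fin m → Fin n) p x → image f (p ∪ ⁅ x ⁆) ≡ image f p ∪ ⁅ f x ⁆
image-∪-⁅⁆ f p x = ⊆-antisym ⊆ ⊇
  where
  ⊆ : ∀ {y} → y ∈ image f (p ∪ ⁅ x ⁆) → y ∈ image f p ∪ ⁅ f x ⁆
  ⊆ y∈ with ∈-image⁻ f (p ∪ ⁅ x ⁆) y∈
  ... | z , z∈ , refl with x∈p∪q⁻ p ⁅ x ⁆ z∈
  ...   | inj₁ z∈p = x∈p∪q⁺ (inj₁ (∈-image⁺ f z∈p))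
  ...   | inj₂ z∈x rewrite x∈⁅y⁆⇒x≡y x z∈x = x∈p∪q⁺ (inj₂ (x∈⁅x⁆ (f x)))
  ⊇ : ∀ {y} → y ∈ image f p ∪ ⁅ f x ⁆ → y ∈ image f (p ∪ ⁅ x ⁆)
  ⊇ y∈ with x∈p∪q⁻ (image f p) ⁅ f x ⁆ y∈
  ... | inj₁ y∈img with ∈-image⁻ f p y∈img
  ...   | z , z∈p , refl = ∈-image⁺ f (x∈p∪q⁺ (inj₁ z∈p))
  ⊇ y∈ | inj₂ y∈fx rewrite x∈⁅y⁆⇒x≡y (f x) y∈fx = ∈-image⁺ f (x∈p∪q⁺ (inj₂ (x∈⁅x⁆ x)))

map-image-size : ∀ {f : Fin m → Fin n} → Injective _≡_ _≡_ f → ∀ {Bs s} → (∀ B → B ∈ₗ Bs → ∣ B ∣ ≡ s)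
               → ∀ E → E ∈ₗ map (image f) Bs → ∣ E ∣ ≡ s
map-image-size f-inj ∣Bs∣ E E∈ with ∈-map⁻ _ E∈
... | B , B∈ , refl = trans (∣image∣ f-inj B) (∣Bs∣ B B∈)

2≤∣p∣ : ∀ {p : Subset n} {x y} → x ∈ p → y ∈ p → x ≢ y → 2 ≤ ∣ p ∣
2≤∣p∣ {p = p} {x} {y} x∈p y∈p x≢y = ≤-trans (s≤s 1≤∣p-x∣) (x∈p⇒∣p-x∣<∣p∣ x∈p)
  where
  1≤∣p-x∣ : 1 ≤ ∣ p - x ∣
  1≤∣p-x∣ = subst (_≤ ∣ p - x ∣) (∣⁅x⁆∣≡1 y) (p⊆q⇒∣p∣≤∣q∣ λ z∈y →
    subst (_∈ p - x) (sym (x∈⁅y⁆⇒x≡y y z∈y)) (x∈p∧x≢y⇒x∈p-y y∈p (x≢y ∘ sym)))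

enum : (p : Subset n) → Fin ∣ p ∣ → Fin n
enum (inside ∷ p)  zero    = zero
enum (inside ∷ p)  (suc i) = suc (enum p i)
enum (outside ∷ p) i       = suc (enum p i)

enum-∈ : ∀ (p : Subset n) i → enum p i ∈ p
enum-∈ (inside ∷ p)  zero    = here
enum-∈ (inside ∷ p)  (suc i) = there (enum-∈ p i)
enum-∈ (outside ∷ p) i       = there (enum-∈ p i)

enum-injective : ∀ (p : Subset n) → Injective _≡_ _≡_ (enum p)
enum-injective (inside ∷ p)  {zero}  {zero}  _ = refl
enum-injective (inside ∷ p)  {suc i} {suc j} e = cong suc (enum-injective p (Finₚ.suc-injective e))
enum-injective (outside ∷ p)                 e = enum-injective p (Finₚ.suc-injective e)

-- The membership argument is irrelevant, so rank p x∈p depends on x alone.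
rank : ∀ (p : Subset n) {x} → .(x ∈ p) → Fin ∣ p ∣
rank (inside ∷ p)  {zero}  _   = zero
rank (inside ∷ p)  {suc x} x∈p = suc (rank p (drop-there x∈p))
rank (outside ∷ p) {suc x} x∈p = rank p (drop-there x∈p)

enum-rank : ∀ (p : Subset n) {x} (x∈p : x ∈ p) → enum p (rank p x∈p) ≡ x
enum-rank (inside ∷ p)  here        = refl
enum-rank (inside ∷ p)  (there x∈p) = cong suc (enum-rank p x∈p)
enum-rank (outside ∷ p) (there x∈p) = cong suc (enum-rank p x∈p)

rank-enum : ∀ (p : Subset n) i → rank p (enum-∈ p i) ≡ i
rank-enum p i = enum-injective p (enum-rank p (enum-∈ p i))

Both : Fin n → Fin n → Subset n → Set
Both x y B = x ∈ B × y ∈ B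

both? : (x y : Fin n) → Decidable (Both x y)
both? x y B = (x ∈? B) ×-dec (y ∈? B)

pairCount-comm : ∀ (Bs : List (Subset n)) x y → pairCount Bs x y ≡ pairCount Bs y x
pairCount-comm Bs x y =
  trans (cong (count (both? x y)) (sym (map-id Bs))) (count-map (both? x y) (both? y x) id swap swap Bs)
  where swap : ∀ {u v B} → Both u v B → Both v u B
        swap (u∈ , v∈) = v∈ , u∈

pairCount-image : ∀ {f : Fin m → Fin n} → Injective _≡_ _≡_ f → ∀ Bs x y
                → pairCount (map (image f) Bs) (f x) (f y) ≡ pairCount Bs x y
pairCount-image {f = f} f-inj Bs x y = count-map (both? (f x) (f y)) (both? x y) (image f) reflect preserve Bs
  where
  reflect : ∀ {B} → Both (f x) (f y) (image f B) → Both x y B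
  reflect (fx∈ , fy∈) = ∈-image⁻-injective f-inj _ fx∈ , ∈-image⁻-injective f-inj _ fy∈
  preserve : ∀ {B} → Both x y B → Both (f x) (f y) (image f B)
  preserve (x∈ , y∈) = ∈-image⁺ f x∈ , ∈-image⁺ f y∈

pairCount-image-∉ : ∀ (f : Fin m → Fin n) Bs {x} → (∀ u → f u ≢ x)
                  → ∀ y → pairCount (map (image f) Bs) x y ≡ 0
pairCount-image-∉ f Bs x∉ y = count-none (both? _ y) (map (image f) Bs) λ E∈ (x∈E , _) →
  case ∈-map⁻ (image f) E∈ of λ where
    (B , _ , refl) → case ∈-image⁻ f B x∈E of λ where
      (u , _ , fu≡x) → x∉ u fu≡x

sameGroup-∃ : ∀ {Gs : List (Subset n)} {x y} → SameGroup Gs x y → ∃ λ G → G ∈ₗ Gs × Both x y G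
sameGroup-∃ = find ∘ 1≤count⇒Any (both? _ _)

∈⇒sameGroup : ∀ {Gs : List (Subset n)} {G x y} → G ∈ₗ Gs → x ∈ G → y ∈ G → SameGroup Gs x y
∈⇒sameGroup G∈ x∈ y∈ = ∈⇒1≤count (both? _ _) G∈ (x∈ , y∈)

transversal-≡ : ∀ {Gs Bs : List (Subset n)} → Transversal Gs Bs → ∀ {B x y} → B ∈ₗ Bs → SameGroup Gs x y
              → x ∈ B → y ∈ B → x ≡ y
transversal-≡ transversal {x = x} {y} B∈ x~y x∈B y∈B with x ≟ y | sameGroup-∃ x~y
... | yes x≡y | _ = x≡y
... | no x≢y  | G , G∈ , x∈G , y∈G =
  ⊥-elim (1+n≰n (≤-trans (2≤∣p∣ (x∈p∩q⁺ (x∈B , x∈G)) (x∈p∩q⁺ (y∈B , y∈G)) x≢y)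
                         (transversal _ G B∈ G∈)))

transversal⇒pairCount≡0 : ∀ {Gs Bs : List (Subset n)} → Transversal Gs Bs
                        → ∀ {x y} → SameGroup Gs x y → x ≢ y → pairCount Bs x y ≡ 0
transversal⇒pairCount≡0 {Bs = Bs} transversal x~y x≢y =
  count-none (both? _ _) Bs λ B∈ (x∈B , y∈B) → x≢y (transversal-≡ transversal B∈ x~y x∈B y∈B)

partition-unique : ∀ {Gs : List (Subset n)} → IsPartition Gs
                 → ∀ {G H x} → G ∈ₗ Gs → H ∈ₗ Gs → x ∈ G → x ∈ H → G ≡ H
partition-unique {Gs = Gs} partition {x = x} G∈ H∈ x∈G x∈H =
  trans (lookup-index G∈)
        (trans (cong (lookup Gs) (count≤1⇒lookup-injective (x ∈?_) Gs (≤-reflexive (partition x))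
                                    (subst (x ∈_) (lookup-index G∈) x∈G) (subst (x ∈_) (lookup-index H∈) x∈H)))
               (sym (lookup-index H∈)))

sameGroup-refl : ∀ {Gs : List (Subset n)} → IsPartition Gs → ∀ x → SameGroup Gs x x
sameGroup-refl {Gs = Gs} partition x =
  case find (1≤count⇒Any (x ∈?_) {Gs} (≤-reflexive (sym (partition x)))) of λ where
    (G , G∈ , x∈G) → ∈⇒sameGroup G∈ x∈G x∈G

sameGroup⇒∈ : ∀ {Gs : List (Subset n)} → IsPartition Gs
            → ∀ {G x y} → SameGroup Gs x y → G ∈ₗ Gs → x ∈ G → y ∈ G
sameGroup⇒∈ partition x~y G∈ x∈G = case sameGroup-∃ x~y of λ where
  (H , H∈ , x∈H , y∈H) → subst (_ ∈_) (partition-unique partition H∈ G∈ x∈H x∈G) y∈H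

-- The point set (Fin m × Fin 3) ∪ {∞}, kept opaque and inspected through view

Point : ℕ → Set
Point m = Fin (3 * m + 1)

opaque
  pt : Fin m → Fin 3 → Point m
  pt p j = combine j p ↑ˡ 1

  ∞ : ∀ m → Point m
  ∞ m = 3 * m ↑ʳ zero

  pt-injective : ∀ {p q : Fin m} {j k} → pt p j ≡ pt q k → p ≡ q × j ≡ k
  pt-injective {p = p} {q} {j} {k} eq with Finₚ.combine-injective j p k q (Finₚ.↑ˡ-injective 1 _ _ eq)
  ... | j≡k , p≡q = p≡q , j≡k

  pt≢∞ : ∀ {p : Fin m} {j} → pt p j ≢ ∞ m
  pt≢∞ {m} {p} {j} eq
    with trans (sym (Finₚ.splitAt-↑ˡ (3 * m) (combine j p) 1))
               (trans (cong (splitAt (3 * m)) eq) (Finₚ.splitAt-↑ʳ (3 * m) 1 zero))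
  ... | ()

data PointView (m : ℕ) : Point m → Set where
  at-∞  : PointView m (∞ m)
  at-pt : ∀ (p : Fin m) j → PointView m (pt p j)

opaque
  unfolding pt ∞

  view : ∀ x → PointView m x
  view {m} x with splitAt (3 * m) x in eq
  ... | inj₂ zero = subst (PointView m) (sym x≡∞) at-∞
    where
    x≡∞ : x ≡ ∞ m
    x≡∞ = trans (sym (Finₚ.join-splitAt (3 * m) 1 x)) (cong (join (3 * m) 1) eq)
  ... | inj₁ w = subst (PointView m) (sym x≡pt) (at-pt p j)
    where
    j : Fin 3
    j = proj₁ (remQuot {3} m w)
    p : Fin m
    p = proj₂ (remQuot {3} m w)
    x≡pt : x ≡ pt p j
    x≡pt = trans (sym (Finₚ.join-splitAt (3 * m) 1 x))
                 (trans (cong (join (3 * m) 1) eq) (cong (_↑ˡ 1) (sym (Finₚ.combine-remQuot {3} m w))))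

  private
    extendFinite : (Fin m → Fin n) → Fin (3 * m) → Fin (3 * n)
    extendFinite {m} f = uncurry combine ∘ map₂ f ∘ remQuot {3} m

  extend : (Fin m → Fin n) → Point m → Point n
  extend {m} {n} f = join (3 * n) 1 ∘ map₁ (extendFinite f) ∘ splitAt (3 * m)

  extend-∞ : ∀ (f : Fin m → Fin n) → extend f (∞ m) ≡ ∞ n
  extend-∞ {m} {n} f = cong (join (3 * n) 1 ∘ map₁ (extendFinite f)) (Finₚ.splitAt-↑ʳ (3 * m) 1 zero)

  extend-pt : ∀ (f : Fin m → Fin n) p j → extend f (pt p j) ≡ pt (f p) j
  extend-pt {m} {n} f p j =
    trans (cong (join (3 * n) 1 ∘ map₁ (extendFinite f)) (Finₚ.splitAt-↑ˡ (3 * m) (combine j p) 1))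
          (cong (λ r → uncurry combine (map₂ f r) ↑ˡ 1) (Finₚ.remQuot-combine j p))

extend-injective : ∀ {f : Fin m → Fin n} → Injective _≡_ _≡_ f → Injective _≡_ _≡_ (extend f)
extend-injective {m = m} {f = f} f-inj {x} {y} eq with view {m} x | view {m} y
... | at-∞      | at-∞      = refl
... | at-∞      | at-pt q k = ⊥-elim (pt≢∞ (trans (sym (extend-pt f q k)) (trans (sym eq) (extend-∞ f))))
... | at-pt p j | at-∞      = ⊥-elim (pt≢∞ (trans (sym (extend-pt f p j)) (trans eq (extend-∞ f))))
... | at-pt p j | at-pt q k with pt-injective (trans (sym (extend-pt f p j)) (trans eq (extend-pt f q k)))
...   | fp≡fq , refl = cong (λ r → pt r j) (f-inj fp≡fq)

extend-enum-rank : ∀ {G : Subset n} {p} (p∈G : p ∈ G) j → extend (enum G) (pt (rank G p∈G) j) ≡ pt p j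
extend-enum-rank {G = G} p∈G j = trans (extend-pt (enum G) _ j) (cong (λ q → pt q j) (enum-rank G p∈G))

extend-enum-∉ : ∀ {G : Subset n} {p} → p ∉ G → ∀ j u → extend (enum G) u ≢ pt p j
extend-enum-∉ {G = G} p∉G j u eq with view {∣ G ∣} u
... | at-∞      = pt≢∞ (trans (sym eq) (extend-∞ (enum G)))
... | at-pt i k with pt-injective (trans (sym (extend-pt (enum G) i k)) eq)
...   | refl , _ = p∉G (enum-∈ G i)

cast-injective : .(eq : m ≡ n) {i j : Fin m} → cast eq i ≡ cast eq j → i ≡ j
cast-injective eq {i} {j} e = trans (sym (Finₚ.cast-involutive (sym eq) eq i))
                                    (trans (cong (cast (sym eq)) e) (Finₚ.cast-involutive (sym eq) eq j))

module Coordinates {t u N : ℕ} {groups : List (Subset N)} (numGroups : length groups ≡ u)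
                   (groupSize : ∀ G → G ∈ₗ groups → ∣ G ∣ ≡ t) (partition : IsPartition groups) where

  private
    Group : Fin (length groups) → Subset N
    Group = lookup groups

    ∣Group∣ : ∀ i → ∣ Group i ∣ ≡ t
    ∣Group∣ i = groupSize (Group i) (∈-lookup i)

    locate : Fin N → Fin (length groups)
    locate x = index (1≤count⇒Any (x ∈?_) {groups} (≤-reflexive (sym (partition x))))

    ∈-locate : ∀ x → x ∈ Group (locate x)
    ∈-locate x = lookup-index (1≤count⇒Any (x ∈?_) {groups} (≤-reflexive (sym (partition x))))

    locate-unique : ∀ {x i} → x ∈ Group i → locate x ≡ i
    locate-unique {x} = count≤1⇒lookup-injective (x ∈?_) groups (≤-reflexive (partition x)) (∈-locate x)

    positionIn : ∀ i {x} → .(x ∈ Group i) → Fin t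
    positionIn i x∈ = cast (∣Group∣ i) (rank (Group i) x∈)

    positionIn-cong : ∀ {i i' x} .{x∈ : x ∈ Group i} .{x∈' : x ∈ Group i'}
                    → i ≡ i' → positionIn i x∈ ≡ positionIn i' x∈'
    positionIn-cong refl = refl

    pointIn : Fin (length groups) → Fin t → Fin N
    pointIn i j = enum (Group i) (cast (sym (∣Group∣ i)) j)

    pointIn-positionIn : ∀ i {x} (x∈ : x ∈ Group i) → pointIn i (positionIn i x∈) ≡ x
    pointIn-positionIn i x∈ =
      trans (cong (enum (Group i)) (Finₚ.cast-involutive (sym (∣Group∣ i)) (∣Group∣ i) _))
            (enum-rank (Group i) x∈)

  group : Fin N → Fin u
  group x = cast numGroups (locate x)

  position : Fin N → Fin t
  position x = positionIn (locate x) (∈-locate x)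

  point : Fin u → Fin t → Fin N
  point i j = pointIn (cast (sym numGroups) i) j

  point-group-position : ∀ x → point (group x) (position x) ≡ x
  point-group-position x =
    trans (cong (λ i → pointIn i (position x)) (Finₚ.cast-involutive (sym numGroups) numGroups (locate x)))
          (pointIn-positionIn (locate x) (∈-locate x))

  group-point : ∀ i j → group (point i j) ≡ i
  group-point i j = trans (cong (cast numGroups) (locate-unique (enum-∈ (Group i') _)))
                          (Finₚ.cast-involutive numGroups (sym numGroups) i)
    where i' = cast (sym numGroups) i

  position-point : ∀ i j → position (point i j) ≡ j
  position-point i j = begin
    position (pointIn i' j)
      ≡⟨ positionIn-cong (locate-unique (enum-∈ (Group i') k)) ⟩
    cast (∣Group∣ i') (rank (Group i') (enum-∈ (Group i') k))
      ≡⟨ cong (cast (∣Group∣ i')) (rank-enum (Group i') k) ⟩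
    cast (∣Group∣ i') k
      ≡⟨ Finₚ.cast-involutive (∣Group∣ i') (sym (∣Group∣ i')) j ⟩
    j ∎
    where
    open ≡-Reasoning
    i' = cast (sym numGroups) i
    k = cast (sym (∣Group∣ i')) j

  sameGroup⇒group-≡ : ∀ {x y} → SameGroup groups x y → group x ≡ group y
  sameGroup⇒group-≡ x~y with sameGroup-∃ {Gs = groups} x~y
  ... | G , G∈ , x∈G , y∈G =
    cong (cast numGroups) (trans (locate-unique (inGroup x∈G)) (sym (locate-unique (inGroup y∈G))))
    where inGroup : ∀ {z} → z ∈ G → z ∈ Group (index G∈)
          inGroup = subst (_ ∈_) (lookup-index G∈)

  group-≡⇒sameGroup : ∀ {x y} → group x ≡ group y → SameGroup groups x y
  group-≡⇒sameGroup {x} {y} gx≡gy = ∈⇒sameGroup {Gs = groups} (∈-lookup (locate x)) (∈-locate x)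
    (subst (λ i → y ∈ Group i) (sym (cast-injective numGroups gx≡gy)) (∈-locate y))

module BlockEmbedding {N} (B : Subset n) {groups : List (Subset N)} (numGroups : length groups ≡ ∣ B ∣)
                      (groupSize : ∀ G → G ∈ₗ groups → ∣ G ∣ ≡ 3) (partition : IsPartition groups) where

  open Coordinates numGroups groupSize partition public

  embed : Fin N → Point n
  embed a = pt (enum B (group a)) (position a)

  embed-injective : Injective _≡_ _≡_ embed
  embed-injective {a} {b} eq with pt-injective eq
  ... | ga≡gb , pa≡pb = begin
    a                            ≡⟨ sym (point-group-position a) ⟩
    point (group a) (position a) ≡⟨ cong₂ point (enum-injective B ga≡gb) pa≡pb ⟩
    point (group b) (position b) ≡⟨ point-group-position b ⟩
    b                            ∎
    where open ≡-Reasoning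

  embed-point : ∀ {p} (p∈B : p ∈ B) j → embed (point (rank B p∈B) j) ≡ pt p j
  embed-point p∈B j = cong₂ pt (trans (cong (enum B) (group-point _ j)) (enum-rank B p∈B)) (position-point _ j)

  embed-∉ : ∀ {p} → p ∉ B → ∀ j a → embed a ≢ pt p j
  embed-∉ p∉B j a eq = p∉B (subst (_∈ B) (proj₁ (pt-injective eq)) (enum-∈ B (group a)))

  embed-≢∞ : ∀ a → embed a ≢ ∞ n
  embed-≢∞ a = pt≢∞

relabel : (Fin m → Fin n) → Subset m × Fin m → Subset n × Fin n
relabel f (B , x) = image f B , f x

CommutesWithRelabel : (∀ {m} → Subset m × Fin m → Subset m) → Set
CommutesWithRelabel g = ∀ {m n} (f : Fin m → Fin n) e → g (relabel f e) ≡ image f (g e)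

map-relabel : (g : ∀ {m} → Subset m × Fin m → Subset m) → CommutesWithRelabel g
            → ∀ (f : Fin m → Fin n) D → map g (map (relabel f) D) ≡ map (image f) (map g D)
map-relabel g g-relabel f D = trans (sym (map-∘ D)) (trans (map-cong (g-relabel f) D) (map-∘ D))

augmentBlock : Subset m × Fin m → Subset m
augmentBlock (B , x) = B ∪ ⁅ x ⁆

module Construction {K L : ℕ → Set} {n} (KG : KGDD K L n)
                    (gdd : ∀ {B} → B ∈ₗ KGDD.blocks KG → NestedGDD 4 1 3 ∣ B ∣) where

  open KGDD KG

  module Embedding {B} (B∈ : B ∈ₗ blocks) =
    BlockEmbedding B (NestedGDD.numGroups (gdd B∈)) (NestedGDD.groupSize (gdd B∈)) (NestedGDD.partition (gdd B∈))
  open Embedding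
    using (embed; embed-injective; embed-point; embed-∉; embed-≢∞; point; group-point;
           group-≡⇒sameGroup; sameGroup⇒group-≡)

  module Assembly (groupBlocks : ∀ {G} → G ∈ₗ groups → List (Subset (3 * ∣ G ∣ + 1)))
                  (blockBlocks : ∀ {B} → B ∈ₗ blocks → List (Subset (3 * ∣ B ∣))) where

    groupCopy : ∀ {G} → G ∈ₗ groups → List (Subset (3 * n + 1))
    groupCopy {G} G∈ = map (image (extend (enum G))) (groupBlocks G∈)

    blockCopy : ∀ {B} → B ∈ₗ blocks → List (Subset (3 * n + 1))
    blockCopy B∈ = map (image (embed B∈)) (blockBlocks B∈)

    assembled : List (Subset (3 * n + 1))
    assembled = concat (mapWith∈ groups groupCopy) ++ concat (mapWith∈ blocks blockCopy)

    assembled-blockSize : ∀ {s} → (∀ {G} (G∈ : G ∈ₗ groups) E → E ∈ₗ groupBlocks G∈ → ∣ E ∣ ≡ s)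
                        → (∀ {B} (B∈ : B ∈ₗ blocks) E → E ∈ₗ blockBlocks B∈ → ∣ E ∣ ≡ s)
                        → ∀ E → E ∈ₗ assembled → ∣ E ∣ ≡ s
    assembled-blockSize groupSizes blockSizes E E∈ with ∈-++⁻ (concat (mapWith∈ groups groupCopy)) E∈
    ... | inj₁ E∈groupPart with ∈-concat-mapWith∈⁻ groups groupCopy E∈groupPart
    ...   | G , G∈ , E∈copy = map-image-size (extend-injective (enum-injective G)) (groupSizes G∈) E E∈copy
    assembled-blockSize groupSizes blockSizes E E∈ | inj₂ E∈blockPart
      with ∈-concat-mapWith∈⁻ blocks blockCopy E∈blockPart
    ...   | B , B∈ , E∈copy = map-image-size (embed-injective B∈) (blockSizes B∈) E E∈copy

    groupSum : Point n → Point n → ℕ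
    groupSum x y = sum (mapWith∈ groups λ G∈ → pairCount (groupCopy G∈) x y)

    blockSum : Point n → Point n → ℕ
    blockSum x y = sum (mapWith∈ blocks λ B∈ → pairCount (blockCopy B∈) x y)

    pairCount-assembled : ∀ x y → pairCount assembled x y ≡ groupSum x y + blockSum x y
    pairCount-assembled x y = begin
      pairCount assembled x y
        ≡⟨ count-++ (both? x y) (concat (mapWith∈ groups groupCopy)) _ ⟩
      pairCount (concat (mapWith∈ groups groupCopy)) x y + pairCount (concat (mapWith∈ blocks blockCopy)) x y
        ≡⟨ cong₂ _+_ (count-concat-mapWith∈ (both? x y) groups groupCopy)
                     (count-concat-mapWith∈ (both? x y) blocks blockCopy) ⟩
      groupSum x y + blockSum x y ∎
      where open ≡-Reasoning

    -- R is _≡ 1 for the blocks of the nested designs and _≤ 2 for their augmented blocks.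
    module Balance {r} (R : ℕ → Set r)
      (groupBalanced : ∀ {G} (G∈ : G ∈ₗ groups) {u v} → u ≢ v → R (pairCount (groupBlocks G∈) u v))
      (blockBalanced : ∀ {B} (B∈ : B ∈ₗ blocks) {a b} → ¬ SameGroup (NestedGDD.groups (gdd B∈)) a b
                     → R (pairCount (blockBlocks B∈) a b))
      (blockTransversal : ∀ {B} (B∈ : B ∈ₗ blocks) → Transversal (NestedGDD.groups (gdd B∈)) (blockBlocks B∈))
      where

      private
        R-+0 : ∀ {a b} → R a → b ≡ 0 → R (a + b)
        R-+0 Ra refl = subst R (sym (+-identityʳ _)) Ra

        R-0+ : ∀ {a b} → a ≡ 0 → R b → R (a + b)
        R-0+ refl Rb = Rb

      groupCopy-inside : ∀ {G} (G∈ : G ∈ₗ groups) {x y} u v → extend (enum G) u ≡ x → extend (enum G) v ≡ y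
                       → x ≢ y → R (pairCount (groupCopy G∈) x y)
      groupCopy-inside {G} G∈ u v refl refl x≢y =
        subst R (sym (pairCount-image (extend-injective (enum-injective G)) (groupBlocks G∈) u v))
                (groupBalanced G∈ (x≢y ∘ cong (extend (enum G))))

      groupCopy-∉ : ∀ {G} (G∈ : G ∈ₗ groups) {p} → p ∉ G → ∀ j y → pairCount (groupCopy G∈) (pt p j) y ≡ 0
      groupCopy-∉ G∈ p∉G j = pairCount-image-∉ _ (groupBlocks G∈) (extend-enum-∉ p∉G j)

      groupCopy-∉ʳ : ∀ {G} (G∈ : G ∈ₗ groups) {q} → q ∉ G → ∀ k x → pairCount (groupCopy G∈) x (pt q k) ≡ 0
      groupCopy-∉ʳ G∈ q∉G k x = trans (pairCount-comm (groupCopy G∈) x _) (groupCopy-∉ G∈ q∉G k x)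

      blockCopy-∉ : ∀ {B} (B∈ : B ∈ₗ blocks) {p} → p ∉ B → ∀ j y → pairCount (blockCopy B∈) (pt p j) y ≡ 0
      blockCopy-∉ B∈ p∉B j = pairCount-image-∉ _ (blockBlocks B∈) (embed-∉ B∈ p∉B j)

      blockCopy-∉ʳ : ∀ {B} (B∈ : B ∈ₗ blocks) {q} → q ∉ B → ∀ k x → pairCount (blockCopy B∈) x (pt q k) ≡ 0
      blockCopy-∉ʳ B∈ q∉B k x = trans (pairCount-comm (blockCopy B∈) x _) (blockCopy-∉ B∈ q∉B k x)

      blockCopy-¬Both : ∀ {B} (B∈ : B ∈ₗ blocks) {p q} → ¬ Both p q B
                      → ∀ j k → pairCount (blockCopy B∈) (pt p j) (pt q k) ≡ 0
      blockCopy-¬Both {B} B∈ {p} {q} ¬both j k with p ∈? B | q ∈? B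
      ... | no p∉B  | _       = blockCopy-∉ B∈ p∉B j _
      ... | yes _   | no q∉B  = blockCopy-∉ʳ B∈ q∉B k _
      ... | yes p∈B | yes q∈B = ⊥-elim (¬both (p∈B , q∈B))

      blockCopy-≡ : ∀ {B} (B∈ : B ∈ₗ blocks) {x y} a b → embed B∈ a ≡ x → embed B∈ b ≡ y
                  → pairCount (blockCopy B∈) x y ≡ pairCount (blockBlocks B∈) a b
      blockCopy-≡ B∈ a b refl refl = pairCount-image (embed-injective B∈) (blockBlocks B∈) a b

      blockCopy-samePoint : ∀ {B} (B∈ : B ∈ₗ blocks) {p} (p∈B : p ∈ B) {j k} → pt p j ≢ pt p k
                          → pairCount (blockCopy B∈) (pt p j) (pt p k) ≡ 0
      blockCopy-samePoint {B} B∈ p∈B {j} {k} x≢y =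
        trans (blockCopy-≡ B∈ a b (embed-point B∈ p∈B j) (embed-point B∈ p∈B k))
              (transversal⇒pairCount≡0 (blockTransversal B∈) a~b a≢b)
        where
        a = point B∈ (rank B p∈B) j
        b = point B∈ (rank B p∈B) k
        a~b : SameGroup (NestedGDD.groups (gdd B∈)) a b
        a~b = group-≡⇒sameGroup B∈ (trans (group-point B∈ _ j) (sym (group-point B∈ _ k)))
        a≢b : a ≢ b
        a≢b a≡b = x≢y (trans (sym (embed-point B∈ p∈B j))
                             (trans (cong (embed B∈) a≡b) (embed-point B∈ p∈B k)))

      blockCopy-distinctPoints : ∀ {B} (B∈ : B ∈ₗ blocks) {p q} → p ∈ B → q ∈ B → p ≢ q
                               → ∀ j k → R (pairCount (blockCopy B∈) (pt p j) (pt q k))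
      blockCopy-distinctPoints {B} B∈ {p} {q} p∈B q∈B p≢q j k =
        subst R (sym (blockCopy-≡ B∈ a b (embed-point B∈ p∈B j) (embed-point B∈ q∈B k)))
                (blockBalanced B∈ a≁b)
        where
        a = point B∈ (rank B p∈B) j
        b = point B∈ (rank B q∈B) k
        a≁b : ¬ SameGroup (NestedGDD.groups (gdd B∈)) a b
        a≁b a~b = p≢q (begin
          p                          ≡⟨ sym (enum-rank B p∈B) ⟩
          enum B (rank B p∈B)        ≡⟨ cong (enum B) (sym (group-point B∈ _ j)) ⟩
          enum B (Embedding.group B∈ a) ≡⟨ cong (enum B) (sameGroup⇒group-≡ B∈ a~b) ⟩
          enum B (Embedding.group B∈ b) ≡⟨ cong (enum B) (group-point B∈ _ k) ⟩
          enum B (rank B q∈B)        ≡⟨ enum-rank B q∈B ⟩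
          q                          ∎)
          where open ≡-Reasoning

      blockCopy-sameGroup : ∀ {B} (B∈ : B ∈ₗ blocks) {p q} → SameGroup groups p q → ∀ {j k} → pt p j ≢ pt q k
                          → pairCount (blockCopy B∈) (pt p j) (pt q k) ≡ 0
      blockCopy-sameGroup {B} B∈ {p} {q} p~q {j} {k} x≢y with p ∈? B | q ∈? B
      ... | no p∉B  | _       = blockCopy-∉ B∈ p∉B j _
      ... | yes _   | no q∉B  = blockCopy-∉ʳ B∈ q∉B k _
      ... | yes p∈B | yes q∈B with transversal-≡ transversal B∈ p~q p∈B q∈B
      ...   | refl = blockCopy-samePoint B∈ p∈B x≢y

      groupCopy-otherGroup : ∀ {G} (G∈ : G ∈ₗ groups) {p q} → ¬ SameGroup groups p q → ∀ j k
                           → pairCount (groupCopy G∈) (pt p j) (pt q k) ≡ 0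
      groupCopy-otherGroup {G} G∈ {p} {q} p≁q j k with p ∈? G | q ∈? G
      ... | no p∉G  | _       = groupCopy-∉ G∈ p∉G j _
      ... | yes _   | no q∉G  = groupCopy-∉ʳ G∈ q∉G k _
      ... | yes p∈G | yes q∈G = ⊥-elim (p≁q (∈⇒sameGroup G∈ p∈G q∈G))

      balanced-∞-pt : ∀ q k → R (pairCount assembled (∞ n) (pt q k))
      balanced-∞-pt q k =
        subst R (sym (pairCount-assembled _ _)) (R-+0 groupPart blockPart)
        where
        groupPart : R (groupSum (∞ n) (pt q k))
        groupPart = sum-mapWith∈-single (q ∈?_) {R} groups _ (partition q)
          (λ {G} G∈ q∈G → groupCopy-inside G∈ (∞ ∣ G ∣) (pt (rank G q∈G) k)
                            (extend-∞ (enum G)) (extend-enum-rank q∈G k) (pt≢∞ ∘ sym))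
          (λ G∈ q∉G → groupCopy-∉ʳ G∈ q∉G k (∞ n))
        blockPart : blockSum (∞ n) (pt q k) ≡ 0
        blockPart = sum-mapWith∈-zero blocks _ λ B∈ →
          pairCount-image-∉ (embed B∈) (blockBlocks B∈) (embed-≢∞ B∈) (pt q k)

      balanced-sameGroup : ∀ {p q} → SameGroup groups p q → ∀ {j k} → pt p j ≢ pt q k
                         → R (pairCount assembled (pt p j) (pt q k))
      balanced-sameGroup {p} {q} p~q {j} {k} x≢y =
        subst R (sym (pairCount-assembled _ _)) (R-+0 groupPart blockPart)
        where
        groupPart : R (groupSum (pt p j) (pt q k))
        groupPart = sum-mapWith∈-single (p ∈?_) {R} groups _ (partition p)
          (λ {G} G∈ p∈G → let q∈G = sameGroup⇒∈ partition p~q G∈ p∈G in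
             groupCopy-inside G∈ (pt (rank G p∈G) j) (pt (rank G q∈G) k)
                              (extend-enum-rank p∈G j) (extend-enum-rank q∈G k) x≢y)
          (λ G∈ p∉G → groupCopy-∉ G∈ p∉G j (pt q k))
        blockPart : blockSum (pt p j) (pt q k) ≡ 0
        blockPart = sum-mapWith∈-zero blocks _ λ B∈ → blockCopy-sameGroup B∈ p~q x≢y

      balanced-otherGroup : ∀ {p q} → ¬ SameGroup groups p q
                          → ∀ j k → R (pairCount assembled (pt p j) (pt q k))
      balanced-otherGroup {p} {q} p≁q j k =
        subst R (sym (pairCount-assembled _ _)) (R-0+ groupPart blockPart)
        where
        groupPart : groupSum (pt p j) (pt q k) ≡ 0
        groupPart = sum-mapWith∈-zero groups _ λ G∈ → groupCopy-otherGroup G∈ p≁q j k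
        p≢q : p ≢ q
        p≢q refl = p≁q (sameGroup-refl {Gs = groups} partition p)
        blockPart : R (blockSum (pt p j) (pt q k))
        blockPart = sum-mapWith∈-single (both? p q) {R} blocks _ (balanced p q p≁q)
          (λ B∈ (p∈B , q∈B) → blockCopy-distinctPoints B∈ p∈B q∈B p≢q j k)
          (λ B∈ ¬both → blockCopy-¬Both B∈ ¬both j k)

      assembled-balanced : ∀ x y → x ≢ y → R (pairCount assembled x y)
      assembled-balanced x y x≢y with view {n} x | view {n} y
      ... | at-∞      | at-∞      = ⊥-elim (x≢y refl)
      ... | at-∞      | at-pt q k = balanced-∞-pt q k
      ... | at-pt p j | at-∞      = subst R (pairCount-comm assembled _ _) (balanced-∞-pt p j)
      ... | at-pt p j | at-pt q k with 1 ≤? pairCount groups p q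
      ...   | yes p~q = balanced-sameGroup p~q x≢y
      ...   | no p≁q  = balanced-otherGroup p≁q j k

  module _ (bibd : ∀ {G} → G ∈ₗ groups → NestedBIBD (3 * ∣ G ∣ + 1) 4 1) where

    groupNesting : ∀ {G} → G ∈ₗ groups → List (Subset (3 * n + 1) × Point n)
    groupNesting {G} G∈ = map (relabel (extend (enum G))) (NestedBIBD.nested (bibd G∈))

    blockNesting : ∀ {B} → B ∈ₗ blocks → List (Subset (3 * n + 1) × Point n)
    blockNesting B∈ = map (relabel (embed B∈)) (NestedGDD.nested (gdd B∈))

    nestedAssembly : List (Subset (3 * n + 1) × Point n)
    nestedAssembly = concat (mapWith∈ groups groupNesting) ++ concat (mapWith∈ blocks blockNesting)

    map-nestedAssembly : (g : ∀ {m} → Subset m × Fin m → Subset m) → CommutesWithRelabel g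
                       → map g nestedAssembly
                       ≡ Assembly.assembled (λ G∈ → map g (NestedBIBD.nested (bibd G∈)))
                                            (λ B∈ → map g (NestedGDD.nested (gdd B∈)))
    map-nestedAssembly g g-relabel = trans (map-++ g (concat (mapWith∈ groups groupNesting)) _) (cong₂ _++_
      (trans (map-concat-mapWith∈ g groups groupNesting)
             (cong concat (mapWith∈-cong groups _ _ λ G∈ → map-relabel g g-relabel _ _)))
      (trans (map-concat-mapWith∈ g blocks blockNesting)
             (cong concat (mapWith∈-cong blocks _ _ λ B∈ → map-relabel g g-relabel _ _))))

    groupBlocks groupAugmented : ∀ {G} → G ∈ₗ groups → List (Subset (3 * ∣ G ∣ + 1))
    groupBlocks G∈    = map proj₁ (NestedBIBD.nested (bibd G∈))
    groupAugmented G∈ = augment (NestedBIBD.nested (bibd G∈))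

    blockBlocks blockAugmented : ∀ {B} → B ∈ₗ blocks → List (Subset (3 * ∣ B ∣))
    blockBlocks B∈    = map proj₁ (NestedGDD.nested (gdd B∈))
    blockAugmented B∈ = augment (NestedGDD.nested (gdd B∈))

    module Plain = Assembly groupBlocks blockBlocks
    module Augmented = Assembly groupAugmented blockAugmented

    nestedAssembly-isBIBD : IsBIBD (3 * n + 1) 4 1 (map proj₁ nestedAssembly)
    nestedAssembly-isBIBD = subst (IsBIBD (3 * n + 1) 4 1) (sym (map-nestedAssembly proj₁ λ _ _ → refl)) record
      { blockSize = Plain.assembled-blockSize
                      (λ G∈ → IsBIBD.blockSize (NestedBIBD.isBIBD (bibd G∈)))
                      (λ B∈ → NestedGDD.blockSize (gdd B∈))
      ; balanced  = Plain.Balance.assembled-balanced (_≡ 1)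
                      (λ G∈ → IsBIBD.balanced (NestedBIBD.isBIBD (bibd G∈)) _ _)
                      (λ B∈ → NestedGDD.balanced (gdd B∈) _ _)
                      (λ B∈ → NestedGDD.transversal (gdd B∈))
      }

    nestedAssembly-isPartial : IsPartialBIBD (3 * n + 1) 5 2 (augment nestedAssembly)
    nestedAssembly-isPartial = subst (IsPartialBIBD (3 * n + 1) 5 2) (sym augment≡) record
      { blockSize = Augmented.assembled-blockSize
                      (λ G∈ → IsPartialBIBD.blockSize (NestedBIBD.isPartial (bibd G∈)))
                      (λ B∈ → NestedGDD.augSize (gdd B∈))
      ; balanced  = Augmented.Balance.assembled-balanced (_≤ 2)
                      (λ G∈ → IsPartialBIBD.balanced (NestedBIBD.isPartial (bibd G∈)) _ _)
                      (λ B∈ → NestedGDD.augBalanced (gdd B∈) _ _)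
                      (λ B∈ → NestedGDD.augTransv (gdd B∈))
      }
      where augment≡ = map-nestedAssembly augmentBlock λ f (B , x) → sym (image-∪-⁅⁆ f B x)

    nestedBIBD : NestedBIBD (3 * n + 1) 4 1
    nestedBIBD = record
      { nested    = nestedAssembly
      ; isBIBD    = nestedAssembly-isBIBD
      ; isPartial = nestedAssembly-isPartial
      }

theorem3p3 : (K L : ℕ → Set)
    → (∀ k → K k → 0 < k) → (∀ l → L l → 0 < l)
    → (n : ℕ) → KGDD K L n
    → (∀ k → K k → NestedGDD 4 1 3 k)
    → (∀ l → L l → NestedBIBD (3 * l + 1) 4 1)
    → NestedBIBD (3 * n + 1) 4 1
theorem3p3 K L _ _ n KG gddOfSize bibdOfSize =
  Construction.nestedBIBD KG (λ {B} B∈ → gddOfSize ∣ B ∣ (blockSize B B∈))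
                             (λ {G} G∈ → bibdOfSize ∣ G ∣ (groupSize G G∈))
  where open KGDD KG
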